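{- Let $v\ge1$, let $\omega_i,\omega_j$ be prime orbits of $\mathbf{K}[v,1]$, and let $\sigma$ be a level-0 substitution such that $\omega_i$ covers $\omega_j$ (partially or fully) under $\sigma$. Then every characteristic minmatrix $\xi\in\mathbf{K}[\![v,1]\!]$ with $\omega_j\subseteq\xi$ also satisfies $\omega_i\subseteq\xi$.
   Context: Formulas are unimodal propositional formulas in $p_0,\dots,p_{v-1}$; $\mathbf{K}$ is the least normal modal logic. $\mathbf{K}[v,1]$ is the Lindenbaum–Tarski algebra of formulas in $p_0,\dots,p_{v-1}$ of modal degree $\le1$ modulo $\mathbf{K}$-equivalence; its atoms (minterms) are the formulas $m_s\wedge\bigwedge_{i=0}^{n-1}(\pm\Diamond m_i)$, where $m_0,\dots,m_{n-1}$ are the $n=2^v$ Boolean minterms $\bigwedge_k\pm p_k$. Each element $\varphi$ is identified with its set $[\varphi]$ of minterms, and a set of minterms with the class of their disjunction. For a normal modal logic $\mathbf{S}$ (normal extension of $\mathbf{K}$), $[\![\mathbf{S}]\!]=\bigcap\{[\varphi]:\varphi\in\mathbf{K}[v,1],\ \mathbf{S}\vdash\varphi\}$ is its characteristic minmatrix, and $\mathbf{K}[\![v,1]\!]$ is the set of all of these. A level-0 substitution is a tuple $\sigma=(\sigma_0,\dots,\sigma_{v-1})$ of classical propositional formulas in $p_0,\dots,p_{v-1}$ acting by $\varphi\circ\sigma=\varphi(\sigma_0,\dots,\sigma_{v-1})$. Prime substitutions are the invertible level-0 substitutions under composition $(\sigma\sigma')_i=\sigma_i(\sigma'_0,\dots,\sigma'_{v-1})$;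 they permute the minterms, and the orbits of this action are the prime orbits. For a set $\omega$ of minterms, $\omega\circ\sigma$ denotes $[(\bigvee\omega)\circ\sigma]$. We say $\omega_i$ covers $\omega_j$ partially under $\sigma$ if $\emptyset\ne(\omega_i\circ\sigma)\cap\omega_j\subsetneq\omega_j$, and fully if $\omega_j\subseteq\omega_i\circ\sigma$ ($i=j$ allowed). -}

module Defs where

open import Data.Nat using (ℕ; zero; suc; _<_; _<?_; _^_)
open import Data.Fin using (Fin; fromℕ<)
open import Data.Bool using (Bool; true; false; if_then_else_)
open import Data.Vec using (Vec; []; _∷_; _++_; lookup; toList)
import Data.Vec as Vec
open import Data.List using (List; foldr; map)
open import Data.List.Membership.Propositional using (_∈_)
open import Data.Product using (Σ; _×_; _,_; ∃)
open import Data.Sum using (_⊎_)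
open import Relation.Nullary using (¬_; yes; no)
open import Function.Bundles using (_⇔_)

infixr 5 _⇒_

data Fm : Set where
  var : ℕ → Fm
  ⊥'  : Fm
  _⇒_ : Fm → Fm → Fm
  □   : Fm → Fm

¬' : Fm → Fm
¬' a = a ⇒ ⊥'

⊤' : Fm
⊤' = ⊥' ⇒ ⊥'

_∧'_ : Fm → Fm → Fm
a ∧' b = ¬' (a ⇒ ¬' b)

_∨'_ : Fm → Fm → Fm
a ∨' b = ¬' a ⇒ b

_⇔'_ : Fm → Fm → Fm
a ⇔' b = (a ⇒ b) ∧' (b ⇒ a)

◇ : Fm → Fm
◇ a = ¬' (□ (¬' a))

⋀ : List Fm → Fm
⋀ = foldr _∧'_ ⊤'

⋁ : List Fm → Fm
⋁ = foldr _∨'_ ⊥'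

sub : (ℕ → Fm) → Fm → Fm
sub s (var k) = s k
sub s ⊥'      = ⊥'
sub s (a ⇒ b) = sub s a ⇒ sub s b
sub s (□ a)   = □ (sub s a)

record NormalLogic (L : Fm → Set) : Set where
  field
    ax1  : ∀ a b → L (a ⇒ b ⇒ a)
    ax2  : ∀ a b c → L ((a ⇒ b ⇒ c) ⇒ (a ⇒ b) ⇒ a ⇒ c)
    ax3  : ∀ a → L (¬' (¬' a) ⇒ a)
    axK  : ∀ a b → L (□ (a ⇒ b) ⇒ □ a ⇒ □ b)
    mp   : ∀ {a b} → L (a ⇒ b) → L a → L b
    nec  : ∀ {a} → L a → L (□ a)
    usub : ∀ (s : ℕ → Fm) {a} → L a → L (sub s a)

data K⊢ : Fm → Set where
  ax1  : ∀ a b → K⊢ (a ⇒ b ⇒ a)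
  ax2  : ∀ a b c → K⊢ ((a ⇒ b ⇒ c) ⇒ (a ⇒ b) ⇒ a ⇒ c)
  ax3  : ∀ a → K⊢ (¬' (¬' a) ⇒ a)
  axK  : ∀ a b → K⊢ (□ (a ⇒ b) ⇒ □ a ⇒ □ b)
  mp   : ∀ {a b} → K⊢ (a ⇒ b) → K⊢ a → K⊢ b
  nec  : ∀ {a} → K⊢ a → K⊢ (□ a)
  usub : ∀ (s : ℕ → Fm) {a} → K⊢ a → K⊢ (sub s a)

data Classical (v : ℕ) : Fm → Set where
  var : ∀ {k} → k < v → Classical v (var k)
  ⊥'  : Classical v ⊥'
  _⇒_ : ∀ {a b} → Classical v a → Classical v b → Classical v (a ⇒ b)

data Deg≤1 (v : ℕ) : Fm → Set where
  var : ∀ {k} → k < v → Deg≤1 v (var k)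
  ⊥'  : Deg≤1 v ⊥'
  _⇒_ : ∀ {a b} → Deg≤1 v a → Deg≤1 v b → Deg≤1 v (a ⇒ b)
  □   : ∀ {a} → Classical v a → Deg≤1 v (□ a)

-- Boolean minterms m₀ … m_{n-1}, n = 2^v, indexed via an enumeration of
-- all valuations of p₀ … p_{v-1}

allVals : ∀ v → Vec (Vec Bool v) (2 ^ v)
allVals zero    = [] ∷ []
allVals (suc v) = Vec.map (true ∷_) (allVals v) ++ (Vec.map (false ∷_) (allVals v) ++ [])

literals : ∀ {v} → ℕ → Vec Bool v → List Fm
literals k []            = List.[]
  where import Data.List as List
literals k (b ∷ bs)      = (if b then var k else ¬' (var k)) List.∷ literals (suc k) bs
  where import Data.List as List

bmin : ∀ v → Fin (2 ^ v) → Fm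
bmin v i = ⋀ (literals 0 (lookup (allVals v) i))

-- Minterms of K[v,1]: m_s ∧ ⋀_i ±◇m_i, given by s and the sign vector
-- s : index of the Boolean minterm m_s;  S : sign vector, S_i = true  iff  +◇m_i
record Minterm (v : ℕ) : Set where
  constructor mt
  field
    s : Fin (2 ^ v)
    S : Vec Bool (2 ^ v)

mform : ∀ {v} → Minterm v → Fm
mform {v} (mt s S) =
  bmin v s ∧' ⋀ (toList (Vec.zipWith (λ i b → if b then ◇ (bmin v i) else ¬' (◇ (bmin v i)))
                                     (Vec.allFin (2 ^ v)) S))

-- [φ] : μ ∈ [φ]  iff  K ⊢ μ → φ   (μ is an atom below φ)
_∈⟦_⟧ : ∀ {v} → Minterm v → Fm → Set
μ ∈⟦ φ ⟧ = K⊢ (mform μ ⇒ φ)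

Level0 : ℕ → Set
Level0 v = Σ (Fin v → Fm) λ σ → ∀ k → Classical v (σ k)

toSub : ∀ {v} → (Fin v → Fm) → ℕ → Fm
toSub {v} σ k with k <? v
... | yes k<v = σ (fromℕ< k<v)
... | no  _   = var k

_∘ₛ_ : ∀ {v} → Fm → Level0 v → Fm
φ ∘ₛ (σ , _) = sub (toSub σ) φ

-- invertible under composition (σσ')_k = σ_k(σ'₀,…,σ'_{v-1}), up to
-- K-equivalence (i.e. as elements of the Lindenbaum–Tarski algebra)
IsPrime : ∀ {v} → Level0 v → Set
IsPrime {v} σ = Σ (Level0 v) λ σ' →
  (∀ (k : Fin v) → K⊢ ((Data.Product.proj₁ σ k ∘ₛ σ') ⇔' var (Data.Fin.toℕ k)))
  × (∀ (k : Fin v) → K⊢ ((Data.Product.proj₁ σ' k ∘ₛ σ) ⇔' var (Data.Fin.toℕ k)))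
  where import Data.Product; import Data.Fin

-- μ ∈ ω ∘ σ  i.e. μ ∈ [ (⋁ω) ∘ σ ]
InComp : ∀ {v} → Minterm v → List (Minterm v) → Level0 v → Set
InComp μ ω σ = μ ∈⟦ ⋁ (map mform ω) ∘ₛ σ ⟧

IsPrimeOrbit : ∀ {v} → List (Minterm v) → Set
IsPrimeOrbit {v} ω = ∃ λ (μ₀ : Minterm v) → ∀ (μ : Minterm v) →
  (μ ∈ ω) ⇔ (∃ λ (τ : Level0 v) → IsPrime τ × (μ ∈⟦ mform μ₀ ∘ₛ τ ⟧))

CoversPartially : ∀ {v} → List (Minterm v) → Level0 v → List (Minterm v) → Set
CoversPartially ωi σ ωj =
  (∃ λ μ → μ ∈ ωj × InComp μ ωi σ) × (∃ λ μ → μ ∈ ωj × ¬ (InComp μ ωi σ))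

CoversFully : ∀ {v} → List (Minterm v) → Level0 v → List (Minterm v) → Set
CoversFully ωi σ ωj = ∀ μ → μ ∈ ωj → InComp μ ωi σ

-- Characteristic minmatrix ⟦S⟧ = ⋂ { [φ] : φ ∈ K[v,1], S ⊢ φ }

InChar : ∀ {v} → (Fm → Set) → Minterm v → Set
InChar {v} L μ = ∀ φ → Deg≤1 v φ → L φ → μ ∈⟦ φ ⟧

-- A minterm μ decides every formula φ of degree ≤ 1: K ⊢ μ → φ or K ⊢ μ → ¬φ. Let μ₀ be the
-- seed of ωᵢ and let μ ∈ ωᵢ lie below μ₀τ for a prime τ with inverse τ′. If μ₀ ⊢ φτ′ for a
-- theorem φ of the logic, then μ ⊢ φτ′τ, which is K-equivalent to φ. Otherwise every member
-- of ωᵢ refutes a substitution instance of φ, so ⋁ωᵢ refutes the conjunction Ψ of these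
-- instances, again a theorem of degree ≤ 1. Covering gives μ′ ∈ ωⱼ with μ′ ⊢ (⋁ωᵢ)σ, which
-- then refutes Ψσ although μ′ ∈ ξ proves it; this contradicts the consistency of minterms,
-- witnessed by a Kripke model with a root and one leaf for each positive sign.

{-# OPTIONS --safe #-}
module Submission where

open import Defs
open import Data.Nat using (ℕ; zero; suc; _+_; _^_; _<_; _<?_; _≤_)
open import Data.Nat.Properties using (+-suc; +-identityʳ)
open import Data.Bool using (Bool; true; false; T; _∧_; if_then_else_)
open import Data.Bool.Properties using (T-∧)
open import Data.Bool.ListAction using (all; and)
open import Data.Unit using (tt)
open import Data.Empty using (⊥-elim)
open import Data.Fin using (Fin; zero; suc; toℕ; fromℕ<; splitAt; join)
open import Data.Fin.Properties using (toℕ-fromℕ<; toℕ<n; join-splitAt)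
open import Data.Vec using (Vec; []; _∷_; lookup; toList; _++_)
import Data.Vec as Vec
open import Data.Vec.Properties using (lookup-map; lookup-splitAt; lookup-zipWith; lookup-allFin; ∷-injectiveˡ; ∷-injectiveʳ)
import Data.Vec.Membership.Propositional.Properties as Vec∈
open import Data.Vec.Relation.Unary.Any using (index)
open import Data.Vec.Relation.Unary.Any.Properties using (lookup-index)
open import Data.List using (List; []; _∷_; [_]; map; filter; allFin)
open import Data.List.Properties using (map-cong)
open import Data.List.Membership.Propositional using (_∈_; lose)
open import Data.List.Membership.Propositional.Properties using (∈-map⁺; ∈-map⁻; ∈-filter⁺; ∈-filter⁻; ∈-allFin)
open import Data.List.Relation.Unary.All as All using (All; []; _∷_)
open import Data.List.Relation.Unary.All.Properties using (all⁺; all⁻)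
open import Data.List.Relation.Unary.Any using (Any; here; there; satisfied)
open import Data.Product using (Σ; _×_; _,_; ∃; proj₁; proj₂; uncurry)
open import Data.Sum using (_⊎_; inj₁; inj₂; [_,_]′)
open import Function using (_∘_; Injective; Equivalence; _⇔_)
open import Relation.Nullary using (¬_; yes; no)
open import Relation.Nullary.Decidable using (T?)
open import Relation.Binary.PropositionalEquality using (_≡_; _≢_; refl; sym; trans; cong; cong₂; subst; subst₂)

infix  3 _⊢_
infixl 9 _·_

data _⊢_ (Γ : List Fm) : Fm → Set where
  hyp : ∀ {a} → a ∈ Γ → Γ ⊢ a
  thm : ∀ {a} → K⊢ a → Γ ⊢ a
  _·_ : ∀ {a b} → Γ ⊢ a ⇒ b → Γ ⊢ a → Γ ⊢ b

⇒-refl : ∀ a → K⊢ (a ⇒ a)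
⇒-refl a = mp (mp (ax2 a (a ⇒ a) a) (ax1 a (a ⇒ a))) (ax1 a a)

⇒-intro : ∀ {Γ a b} → a ∷ Γ ⊢ b → Γ ⊢ a ⇒ b
⇒-intro (hyp (here refl)) = thm (⇒-refl _)
⇒-intro (hyp (there p))   = thm (ax1 _ _) · hyp p
⇒-intro (thm p)           = thm (ax1 _ _) · thm p
⇒-intro (p · q)           = thm (ax2 _ _ _) · ⇒-intro p · ⇒-intro q

weaken : ∀ {Γ a b} → Γ ⊢ a → b ∷ Γ ⊢ a
weaken (hyp p) = hyp (there p)
weaken (thm p) = thm p
weaken (p · q) = weaken p · weaken q

closed : ∀ {a} → [] ⊢ a → K⊢ a
closed (hyp ())
closed (thm p) = p
closed (p · q) = mp (closed p) (closed q)

derive : ∀ {a b} → [ a ] ⊢ b → K⊢ (a ⇒ b)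
derive p = closed (⇒-intro p)

#0 : ∀ {Γ a} → a ∷ Γ ⊢ a
#0 = hyp (here refl)

#1 : ∀ {Γ a b} → b ∷ a ∷ Γ ⊢ a
#1 = hyp (there (here refl))

#2 : ∀ {Γ a b c} → c ∷ b ∷ a ∷ Γ ⊢ a
#2 = hyp (there (there (here refl)))

⊥'-elim : ∀ {Γ a} → Γ ⊢ ⊥' → Γ ⊢ a
⊥'-elim p = thm (ax3 _) · ⇒-intro (weaken p)

by-contradiction : ∀ {Γ a} → ¬' a ∷ Γ ⊢ ⊥' → Γ ⊢ a
by-contradiction p = thm (ax3 _) · ⇒-intro p

∧-intro : ∀ {Γ a b} → Γ ⊢ a → Γ ⊢ b → Γ ⊢ a ∧' b
∧-intro p q = ⇒-intro (#0 · weaken p · weaken q)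

∧-elimˡ : ∀ {Γ a b} → Γ ⊢ a ∧' b → Γ ⊢ a
∧-elimˡ p = by-contradiction (weaken p · ⇒-intro (⇒-intro (⊥'-elim (#2 · #1))))

∧-elimʳ : ∀ {Γ a b} → Γ ⊢ a ∧' b → Γ ⊢ b
∧-elimʳ p = by-contradiction (weaken p · ⇒-intro (weaken #0))

∨-introˡ : ∀ {Γ a b} → Γ ⊢ a → Γ ⊢ a ∨' b
∨-introˡ p = ⇒-intro (⊥'-elim (#0 · weaken p))

∨-introʳ : ∀ {Γ a b} → Γ ⊢ b → Γ ⊢ a ∨' b
∨-introʳ p = ⇒-intro (weaken p)

∨-elim : ∀ {Γ a b c} → Γ ⊢ a ∨' b → Γ ⊢ a ⇒ c → Γ ⊢ b ⇒ c → Γ ⊢ c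
∨-elim p q r =
  by-contradiction (#0 · (weaken r · (weaken p · ⇒-intro (#1 · (weaken (weaken q) · #0)))))

⇒-trans : ∀ {a b c} → K⊢ (a ⇒ b) → K⊢ (b ⇒ c) → K⊢ (a ⇒ c)
⇒-trans p q = derive (thm q · (thm p · #0))

contraposition : ∀ {a b} → K⊢ (a ⇒ b) → K⊢ (¬' b ⇒ ¬' a)
contraposition p = derive (⇒-intro (#1 · (thm p · #0)))

¬¬-intro : ∀ a → K⊢ (a ⇒ ¬' (¬' a))
¬¬-intro a = derive (⇒-intro (#0 · #1))

□-mono : ∀ {a b} → K⊢ (a ⇒ b) → K⊢ (□ a ⇒ □ b)
□-mono {a} {b} p = mp (axK a b) (nec p)

□-mono₂ : ∀ {a b c} → K⊢ (a ⇒ b ⇒ c) → K⊢ (□ a ⇒ □ b ⇒ □ c)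
□-mono₂ {a} {b} {c} p = derive (⇒-intro (thm (axK b c) · (thm (□-mono p) · #1) · #0))

◇-mono : ∀ {a b} → K⊢ (a ⇒ b) → K⊢ (◇ a ⇒ ◇ b)
◇-mono p = contraposition (□-mono (contraposition p))

⋀-elim : ∀ {x xs} → x ∈ xs → K⊢ (⋀ xs ⇒ x)
⋀-elim (here refl) = derive (∧-elimˡ #0)
⋀-elim (there p)   = ⇒-trans (derive (∧-elimʳ #0)) (⋀-elim p)

module _ {A : Set} (f : A → Fm) where

  ⋁-map-intro : ∀ {x xs} → x ∈ xs → K⊢ (f x ⇒ ⋁ (map f xs))
  ⋁-map-intro (here refl) = derive (∨-introˡ #0)
  ⋁-map-intro (there p)   = ⇒-trans (⋁-map-intro p) (derive (∨-introʳ #0))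

  ⋁-map-elim : ∀ {c} xs → (∀ {x} → x ∈ xs → K⊢ (f x ⇒ c)) → K⊢ (⋁ (map f xs) ⇒ c)
  ⋁-map-elim []       h = derive (⊥'-elim #0)
  ⋁-map-elim (x ∷ xs) h =
    derive (∨-elim #0 (thm (h (here refl))) (thm (⋁-map-elim xs (λ p → h (there p)))))

-- Minterms decide every formula of modal degree ≤ 1

literal : Bool → ℕ → Fm
literal b k = if b then var k else ¬' (var k)

sign : Bool → Fm → Fm
sign b a = if b then ◇ a else ¬' (◇ a)

signs : ∀ v → Vec Bool (2 ^ v) → Vec Fm (2 ^ v)
signs v S = Vec.zipWith (λ i b → sign b (bmin v i)) (Vec.allFin (2 ^ v)) S

lookup-signs : ∀ v S i → lookup (signs v S) i ≡ sign (lookup S i) (bmin v i)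
lookup-signs v S i = trans (lookup-zipWith _ i (Vec.allFin (2 ^ v)) S)
                           (cong (λ j → sign (lookup S i) (bmin v j)) (lookup-allFin i))

Decides : Fm → Fm → Set
Decides X a = K⊢ (X ⇒ a) ⊎ K⊢ (X ⇒ ¬' a)

Decides-⊥ : ∀ X → Decides X ⊥'
Decides-⊥ X = inj₂ (derive (thm (⇒-refl ⊥')))

Decides-⇒ : ∀ {X a b} → Decides X a → Decides X b → Decides X (a ⇒ b)
Decides-⇒ (inj₂ ¬a) _        = inj₁ (derive (⇒-intro (⊥'-elim (thm ¬a · #1 · #0))))
Decides-⇒ (inj₁ a)  (inj₁ b)  = inj₁ (derive (⇒-intro (thm b · #1)))
Decides-⇒ (inj₁ a)  (inj₂ ¬b) = inj₂ (derive (⇒-intro (thm ¬b · #1 · (#0 · (thm a · #1)))))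

Decides-strengthen : ∀ {X Y a} → K⊢ (X ⇒ Y) → Decides Y a → Decides X a
Decides-strengthen X⇒Y (inj₁ p) = inj₁ (⇒-trans X⇒Y p)
Decides-strengthen X⇒Y (inj₂ p) = inj₂ (⇒-trans X⇒Y p)

module _ {v X} (decides-var : ∀ {k} → k < v → Decides X (var k)) where

  decides-classical : ∀ {a} → Classical v a → Decides X a
  decides-classical (var k<v) = decides-var k<v
  decides-classical ⊥'        = Decides-⊥ X
  decides-classical (p ⇒ q)   = Decides-⇒ (decides-classical p) (decides-classical q)

  decides-deg≤1 : (∀ {b} → Classical v b → Decides X (□ b)) → ∀ {a} → Deg≤1 v a → Decides X a
  decides-deg≤1 decides-□ (var k<v) = decides-var k<v
  decides-deg≤1 decides-□ ⊥'        = Decides-⊥ X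
  decides-deg≤1 decides-□ (p ⇒ q)   =
    Decides-⇒ (decides-deg≤1 decides-□ p) (decides-deg≤1 decides-□ q)
  decides-deg≤1 decides-□ (□ c)     = decides-□ c

literal-∈ : ∀ {m} j (bs : Vec Bool m) i → literal (lookup bs i) (j + toℕ i) ∈ literals j bs
literal-∈ j (b ∷ bs) zero    = here (cong (literal b) (+-identityʳ j))
literal-∈ j (b ∷ bs) (suc i) =
  there (subst (λ k → literal (lookup bs i) k ∈ literals (suc j) bs) (sym (+-suc j (toℕ i)))
               (literal-∈ (suc j) bs i))

literal-decides : ∀ {X} b k → K⊢ (X ⇒ literal b k) → Decides X (var k)
literal-decides true  k p = inj₁ p
literal-decides false k p = inj₂ p

bmin-decides-var : ∀ v i {k} → k < v → Decides (bmin v i) (var k)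
bmin-decides-var v i k<v = subst (Decides (bmin v i) ∘ var) (toℕ-fromℕ< k<v)
  (literal-decides _ _ (⋀-elim (literal-∈ 0 (lookup (allVals v) i) (fromℕ< k<v))))

allVals-∷-∈ : ∀ {v} b {bs} → bs ∈ toList (allVals v) → b ∷ bs ∈ toList (allVals (suc v))
allVals-∷-∈ true  p = Vec∈.∈-toList⁺ (Vec∈.∈-++⁺ˡ (Vec∈.∈-map⁺ (true ∷_) (Vec∈.∈-toList⁻ p)))
allVals-∷-∈ {v} false p = Vec∈.∈-toList⁺ (Vec∈.∈-++⁺ʳ (Vec.map (true ∷_) (allVals v))
                                           (Vec∈.∈-++⁺ˡ (Vec∈.∈-map⁺ (false ∷_) (Vec∈.∈-toList⁻ p))))

literals-exhaustive : ∀ v j → K⊢ (⋁ (map (⋀ ∘ literals j) (toList (allVals v))))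
literals-exhaustive zero    j = closed (∨-introˡ (thm (⇒-refl ⊥')))
literals-exhaustive (suc v) j =
  closed (∨-elim (thm (⇒-refl (¬' (var j)))) (thm (extend true) · ih) (thm (extend false) · ih))
  where
  ih = thm (literals-exhaustive v (suc j))
  extend : ∀ b → K⊢ (⋁ (map (⋀ ∘ literals (suc j)) (toList (allVals v))) ⇒
                      literal b j ⇒ ⋁ (map (⋀ ∘ literals j) (toList (allVals (suc v)))))
  extend b = ⋁-map-elim (⋀ ∘ literals (suc j)) (toList (allVals v)) λ p →
    derive (⇒-intro (thm (⋁-map-intro (⋀ ∘ literals j) (allVals-∷-∈ b p)) · ∧-intro #0 #1))

bmin-exhaustive : ∀ v → K⊢ (⋁ (map (bmin v) (allFin (2 ^ v))))
bmin-exhaustive v =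
  mp (⋁-map-elim (⋀ ∘ literals 0) (toList (allVals v)) to-bmin) (literals-exhaustive v 0)
  where
  to-bmin : ∀ {bs} → bs ∈ toList (allVals v) →
            K⊢ (⋀ (literals 0 bs) ⇒ ⋁ (map (bmin v) (allFin (2 ^ v))))
  to-bmin p with Vec∈.∈-toList⁻ p
  ... | p′ rewrite lookup-index p′ = ⋁-map-intro (bmin v) (∈-allFin (index p′))

mform-sign : ∀ {v} s S i → K⊢ (mform {v} (mt s S) ⇒ sign (lookup S i) (bmin v i))
mform-sign {v} s S i = ⇒-trans (derive (∧-elimʳ #0)) (⋀-elim sign-∈)
  where
  sign-∈ : sign (lookup S i) (bmin v i) ∈ toList (signs v S)
  sign-∈ = subst (_∈ toList (signs v S)) (lookup-signs v S i)
                 (Vec∈.∈-toList⁺ (Vec∈.∈-lookup i (signs v S)))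

□-⋁-map : ∀ {A : Set} (f : A → Fm) {X a} xs →
          (∀ {x} → x ∈ xs → K⊢ (X ⇒ □ (f x ⇒ a))) → K⊢ (X ⇒ □ (⋁ (map f xs) ⇒ a))
□-⋁-map f []       h = derive (thm (nec (derive (⊥'-elim #0))))
□-⋁-map f (x ∷ xs) h =
  derive (thm (□-mono₂ case-split) · (thm (h (here refl)) · #0)
                                    · (thm (□-⋁-map f xs (h ∘ there)) · #0))
  where
  case-split : ∀ {b c a} → K⊢ ((b ⇒ a) ⇒ (c ⇒ a) ⇒ (b ∨' c) ⇒ a)
  case-split = derive (⇒-intro (⇒-intro (∨-elim #0 #2 #1)))

sign-splits-□ : ∀ {X m a} b → K⊢ (X ⇒ sign b m) → Decides m a →
                K⊢ (X ⇒ □ (m ⇒ a)) ⊎ K⊢ (X ⇒ ¬' (□ a))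
sign-splits-□ _ _ (inj₁ m⇒a) = inj₁ (derive (thm (nec m⇒a)))
sign-splits-□ {a = a} true  X⇒◇m  (inj₂ m⇒¬a) =
  inj₂ (⇒-trans X⇒◇m (⇒-trans (◇-mono m⇒¬a) (contraposition (□-mono (¬¬-intro a)))))
sign-splits-□ false X⇒¬◇m (inj₂ _) =
  inj₁ (⇒-trans X⇒¬◇m (⇒-trans (ax3 _) (□-mono (derive (⇒-intro (⊥'-elim (#1 · #0)))))))

mform-decides-□ : ∀ {v} s S {a} → Classical v a → Decides (mform {v} (mt s S)) (□ a)
mform-decides-□ {v} s S {a} ca with All.decide split (allFin (2 ^ v))
  where
  split : ∀ i → K⊢ (mform {v} (mt s S) ⇒ □ (bmin v i ⇒ a)) ⊎ K⊢ (mform {v} (mt s S) ⇒ ¬' (□ a))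
  split i = sign-splits-□ (lookup S i) (mform-sign {v} s S i)
                          (decides-classical (bmin-decides-var v i) ca)
... | inj₁ all  = inj₁ (derive (thm (axK _ _) · (thm (□-⋁-map (bmin v) _ (All.lookup all)) · #0)
                                                · thm (nec (bmin-exhaustive v))))
... | inj₂ some = inj₂ (proj₂ (satisfied some))

mform-decides : ∀ {v} (μ : Minterm v) {a} → Deg≤1 v a → Decides (mform μ) a
mform-decides {v} (mt s S) =
  decides-deg≤1 (λ k<v → Decides-strengthen (derive (∧-elimˡ #0)) (bmin-decides-var v s k<v))
                (mform-decides-□ s S)

-- Kripke semantics

infixr 5 _⇒ᵇ_

_⇒ᵇ_ : Bool → Bool → Bool
true  ⇒ᵇ y = y
false ⇒ᵇ _ = true

⇒ᵇ-intro : ∀ {x y} → (T x → T y) → T (x ⇒ᵇ y)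
⇒ᵇ-intro {true}  f = f tt
⇒ᵇ-intro {false} f = tt

⇒ᵇ-elim : ∀ {x y} → T (x ⇒ᵇ y) → T x → T y
⇒ᵇ-elim {true} p _ = p

¬¬ᵇ-elim : ∀ x → T ((x ⇒ᵇ false) ⇒ᵇ false) → T x
¬¬ᵇ-elim true _ = tt

ax1ᵇ : ∀ x y → T (x ⇒ᵇ y ⇒ᵇ x)
ax1ᵇ x y = ⇒ᵇ-intro {x} λ t → ⇒ᵇ-intro {y} λ _ → t

ax2ᵇ : ∀ x y z → T ((x ⇒ᵇ y ⇒ᵇ z) ⇒ᵇ (x ⇒ᵇ y) ⇒ᵇ x ⇒ᵇ z)
ax2ᵇ x y z = ⇒ᵇ-intro {x ⇒ᵇ y ⇒ᵇ z} λ f → ⇒ᵇ-intro {x ⇒ᵇ y} λ g → ⇒ᵇ-intro {x} λ t →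
  ⇒ᵇ-elim {y} (⇒ᵇ-elim {x} f t) (⇒ᵇ-elim {x} g t)

all-⇒ᵇ : ∀ {A : Set} (p q : A → Bool) xs →
         T (all (λ x → p x ⇒ᵇ q x) xs ⇒ᵇ all p xs ⇒ᵇ all q xs)
all-⇒ᵇ p q xs = ⇒ᵇ-intro {all _ xs} λ f → ⇒ᵇ-intro {all p xs} λ x →
  all⁻ q (All.zipWith (uncurry ⇒ᵇ-elim) (all⁺ _ xs f , all⁺ p xs x))

record Model : Set₁ where
  constructor model
  field
    World : Set
    succ  : World → List World
    val   : ℕ → World → Bool

open Model

eval : (M : Model) → World M → Fm → Bool
eval M w (var k) = val M k w
eval M w ⊥'      = false
eval M w (a ⇒ b) = eval M w a ⇒ᵇ eval M w b
eval M w (□ a)   = all (λ u → eval M u a) (succ M w)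

module _ {M : Model} {w : World M} where

  eval-∧' : ∀ a b → eval M w (a ∧' b) ≡ eval M w a ∧ eval M w b
  eval-∧' a b with eval M w a | eval M w b
  ... | true  | true  = refl
  ... | true  | false = refl
  ... | false | _     = refl

  T-◇⁺ : ∀ a → Any (λ u → T (eval M u a)) (succ M w) → T (eval M w (◇ a))
  T-◇⁺ a any = ⇒ᵇ-intro λ □¬a → uncurry ⇒ᵇ-elim (All.lookupAny (all⁺ _ _ □¬a) any)

  T-¬◇⁺ : ∀ a → All (λ u → ¬ T (eval M u a)) (succ M w) → T (eval M w (¬' (◇ a)))
  T-¬◇⁺ a none = ⇒ᵇ-intro λ ◇a → ⇒ᵇ-elim ◇a (all⁻ _ (All.map ⇒ᵇ-intro none))

substModel : Model → (ℕ → Fm) → Model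
substModel M s = model (World M) (succ M) (λ k w → eval M w (s k))

eval-sub : ∀ M s w a → eval M w (sub s a) ≡ eval (substModel M s) w a
eval-sub M s w (var k) = refl
eval-sub M s w ⊥'      = refl
eval-sub M s w (a ⇒ b) = cong₂ _⇒ᵇ_ (eval-sub M s w a) (eval-sub M s w b)
eval-sub M s w (□ a)   = cong and (map-cong (λ u → eval-sub M s u a) (succ M w))

sound : ∀ {a} → K⊢ a → ∀ M w → T (eval M w a)
sound (ax1 a b)   M w = ax1ᵇ (eval M w a) (eval M w b)
sound (ax2 a b c) M w = ax2ᵇ (eval M w a) (eval M w b) (eval M w c)
sound (ax3 a)     M w = ⇒ᵇ-intro (¬¬ᵇ-elim (eval M w a))
sound (axK a b)   M w = all-⇒ᵇ (λ u → eval M u a) (λ u → eval M u b) (succ M w)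
sound (mp p q)    M w = ⇒ᵇ-elim (sound p M w) (sound q M w)
sound (nec p)     M w = all⁻ _ (All.universal (sound p M) (succ M w))
sound (usub s {a} p) M w rewrite eval-sub M s w a = sound p (substModel M s) w

-- Consistency of minterms

module _ {A B C : Set} {f : A → C} {g : B → C} where

  [,]′-injective : Injective _≡_ _≡_ f → Injective _≡_ _≡_ g → (∀ a b → f a ≢ g b) →
                   Injective _≡_ _≡_ [ f , g ]′
  [,]′-injective f-inj g-inj f≢g {inj₁ a} {inj₁ a′} e = cong inj₁ (f-inj e)
  [,]′-injective f-inj g-inj f≢g {inj₁ a} {inj₂ b}  e = ⊥-elim (f≢g a b e)
  [,]′-injective f-inj g-inj f≢g {inj₂ b} {inj₁ a}  e = ⊥-elim (f≢g a b (sym e))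
  [,]′-injective f-inj g-inj f≢g {inj₂ b} {inj₂ b′} e = cong inj₂ (g-inj e)

splitAt-injective : ∀ m {n} → Injective _≡_ _≡_ (splitAt m {n})
splitAt-injective m {n} {i} {j} e =
  trans (sym (join-splitAt m n i)) (trans (cong (join m n) e) (join-splitAt m n j))

module _ {A : Set} {m n : ℕ} (xs : Vec A m) (ys : Vec A n) where

  lookup-++-injective : Injective _≡_ _≡_ (lookup xs) → Injective _≡_ _≡_ (lookup ys) →
                        (∀ i j → lookup xs i ≢ lookup ys j) → Injective _≡_ _≡_ (lookup (xs ++ ys))
  lookup-++-injective xs-inj ys-inj xs≢ys {i} {j} e =
    splitAt-injective m ([,]′-injective xs-inj ys-inj xs≢ys
      (trans (sym (lookup-splitAt m xs ys i)) (trans e (lookup-splitAt m xs ys j))))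

lookup-map-injective : ∀ {A B : Set} {n} {f : A → B} (xs : Vec A n) → Injective _≡_ _≡_ f →
                       Injective _≡_ _≡_ (lookup xs) → Injective _≡_ _≡_ (lookup (Vec.map f xs))
lookup-map-injective {f = f} xs f-inj xs-inj {i} {j} e =
  xs-inj (f-inj (trans (sym (lookup-map i f xs)) (trans e (lookup-map j f xs))))

lookup-++-[] : ∀ {A : Set} {n} (xs : Vec A n) j → ∃ λ i → lookup (xs ++ []) j ≡ lookup xs i
lookup-++-[] {n = n} xs j with splitAt n j | lookup-splitAt n xs [] j
... | inj₁ i | e = i , e

allVals-injective : ∀ v → Injective _≡_ _≡_ (lookup (allVals v))
allVals-injective zero {zero} {zero} _ = refl
allVals-injective (suc v) =
  lookup-++-injective (Vec.map (true ∷_) A) (Vec.map (false ∷_) A ++ [])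
    (lookup-map-injective A ∷-injectiveʳ (allVals-injective v))
    (lookup-++-injective (Vec.map (false ∷_) A) []
      (lookup-map-injective A ∷-injectiveʳ (allVals-injective v)) (λ { {()} }) (λ _ ()))
    heads-differ
  where
  A = allVals v
  heads-differ : ∀ i j → lookup (Vec.map (true ∷_) A) i ≢ lookup (Vec.map (false ∷_) A ++ []) j
  heads-differ i j e with lookup-++-[] (Vec.map (false ∷_) A) j
  ... | j′ , e′
    with ∷-injectiveˡ (trans (sym (lookup-map i (true ∷_) A))
                        (trans e (trans e′ (lookup-map j′ (false ∷_) A))))
  ... | ()

All-toList : ∀ {A : Set} {P : A → Set} {n} (xs : Vec A n) →
             (∀ i → P (lookup xs i)) → All P (toList xs)
All-toList []       h = []
All-toList (x ∷ xs) h = h zero ∷ All-toList xs (λ i → h (suc i))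

valuation : ∀ {m} → Vec Bool m → ℕ → Bool
valuation []       _       = false
valuation (b ∷ bs) zero    = b
valuation (b ∷ bs) (suc k) = valuation bs k

module _ {M : Model} {w : World M} where

  T-∧' : ∀ a b → T (eval M w (a ∧' b)) ⇔ (T (eval M w a) × T (eval M w b))
  T-∧' a b rewrite eval-∧' {M} {w} a b = T-∧

  T-⋀ : ∀ {xs} → All (T ∘ eval M w) xs → T (eval M w (⋀ xs))
  T-⋀ {[]}     []       = tt
  T-⋀ {x ∷ xs} (p ∷ ps) = Equivalence.from (T-∧' x (⋀ xs)) (p , T-⋀ ps)

  Realises : ∀ {m} → ℕ → Vec Bool m → Set
  Realises j ws = ∀ k → val M (j + k) w ≡ valuation ws k

  realises-head : ∀ {m j b} {bs : Vec Bool m} → Realises j (b ∷ bs) → val M j w ≡ b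
  realises-head {j = j} {b} h = subst (λ k → val M k w ≡ b) (+-identityʳ j) (h 0)

  realises-tail : ∀ {m j b} {bs : Vec Bool m} → Realises j (b ∷ bs) → Realises (suc j) bs
  realises-tail {j = j} {bs = bs} h k =
    subst (λ i → val M i w ≡ valuation bs k) (+-suc j k) (h (suc k))

  T-literal⁺ : ∀ {b k} → val M k w ≡ b → T (eval M w (literal b k))
  T-literal⁺ {true}  e rewrite e = tt
  T-literal⁺ {false} e rewrite e = tt

  T-literal⁻ : ∀ b k → T (eval M w (literal b k)) → val M k w ≡ b
  T-literal⁻ true  k t with val M k w
  ... | true = refl
  T-literal⁻ false k t with val M k w
  ... | false = refl

  T-literals⁺ : ∀ {m} j (bs : Vec Bool m) → Realises j bs → T (eval M w (⋀ (literals j bs)))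
  T-literals⁺ j []       h = tt
  T-literals⁺ j (b ∷ bs) h = Equivalence.from (T-∧' (literal b j) (⋀ (literals (suc j) bs)))
    (T-literal⁺ (realises-head h) , T-literals⁺ (suc j) bs (realises-tail h))

  T-literals⁻ : ∀ {m} j (bs ws : Vec Bool m) → Realises j ws →
                T (eval M w (⋀ (literals j bs))) → bs ≡ ws
  T-literals⁻ j []       []       h t = refl
  T-literals⁻ j (b ∷ bs) (c ∷ ws) h t
    with Equivalence.to (T-∧' (literal b j) (⋀ (literals (suc j) bs))) t
  ... | tb , tbs = cong₂ _∷_ (trans (sym (T-literal⁻ b j tb)) (realises-head h))
                             (T-literals⁻ (suc j) bs ws (realises-tail h) tbs)

data Node (n : ℕ) : Set where
  root : Node n
  leaf : Fin n → Node n

module _ {v} (μ : Minterm v) where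
  open Minterm μ

  label : Node (2 ^ v) → Vec Bool v
  label root     = lookup (allVals v) s
  label (leaf i) = lookup (allVals v) i

  children : List (Fin (2 ^ v))
  children = filter (λ i → T? (lookup S i)) (allFin (2 ^ v))

  successors : Node (2 ^ v) → List (Node (2 ^ v))
  successors root     = map leaf children
  successors (leaf _) = []

  mintermModel : Model
  mintermModel = model (Node (2 ^ v)) successors (λ k u → valuation (label u) k)

  leaf-⊨-bmin : ∀ i → T (eval mintermModel (leaf i) (bmin v i))
  leaf-⊨-bmin i = T-literals⁺ 0 (lookup (allVals v) i) (λ k → refl)

  leaf-⊨-bmin-unique : ∀ i j → T (eval mintermModel (leaf j) (bmin v i)) → i ≡ j
  leaf-⊨-bmin-unique i j t = allVals-injective v (T-literals⁻ 0 _ _ (λ k → refl) t)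

  no-child-⊨-bmin : ∀ {i u} → lookup S i ≡ false → u ∈ successors root →
                   ¬ T (eval mintermModel u (bmin v i))
  no-child-⊨-bmin {i} Si≡false u∈ t with ∈-map⁻ leaf u∈
  ... | j , j∈ , refl with ∈-filter⁻ (λ j → T? (lookup S j)) {xs = allFin (2 ^ v)} j∈
  ... | _ , Sj with leaf-⊨-bmin-unique i j t
  ... | refl = subst T Si≡false Sj

  root-⊨-sign : ∀ i → T (eval mintermModel root (sign (lookup S i) (bmin v i)))
  root-⊨-sign i with lookup S i in Si
  ... | true  = T-◇⁺ {mintermModel} {root} (bmin v i) (lose leaf-i-child (leaf-⊨-bmin i))
    where
    leaf-i-child : leaf i ∈ successors root
    leaf-i-child = ∈-map⁺ leaf (∈-filter⁺ (λ j → T? (lookup S j)) (∈-allFin i) (subst T (sym Si) tt))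
  ... | false = T-¬◇⁺ {mintermModel} {root} (bmin v i) (All.tabulate (no-child-⊨-bmin Si))

  root-⊨-mform : T (eval mintermModel root (mform μ))
  root-⊨-mform = Equivalence.from (T-∧' (bmin v s) (⋀ (toList (signs v S))))
    ( T-literals⁺ 0 (lookup (allVals v) s) (λ k → refl)
    , T-⋀ (All-toList (signs v S) λ i →
             subst (T ∘ eval mintermModel root) (sym (lookup-signs v S i)) (root-⊨-sign i)))

minterm-consistent : ∀ {v} (μ : Minterm v) → ¬ K⊢ (mform μ ⇒ ⊥')
minterm-consistent μ ⊢¬μ =
  ⇒ᵇ-elim {eval (mintermModel μ) root (mform μ)} (sound ⊢¬μ (mintermModel μ) root) (root-⊨-mform μ)

toSub-< : ∀ {v} (σ : Fin v → Fm) {k} (k<v : k < v) → toSub σ k ≡ σ (fromℕ< k<v)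
toSub-< {v} σ {k} k<v with k <? v
... | yes _   = refl
... | no  k≮v = ⊥-elim (k≮v k<v)

toSub-≮ : ∀ {v} (σ : Fin v → Fm) {k} → ¬ k < v → toSub σ k ≡ var k
toSub-≮ {v} σ {k} k≮v with k <? v
... | yes k<v = ⊥-elim (k≮v k<v)
... | no  _   = refl

Classical⇒Deg≤1 : ∀ {v a} → Classical v a → Deg≤1 v a
Classical⇒Deg≤1 (var k<v) = var k<v
Classical⇒Deg≤1 ⊥'        = ⊥'
Classical⇒Deg≤1 (p ⇒ q)   = Classical⇒Deg≤1 p ⇒ Classical⇒Deg≤1 q

Classical-∘ₛ : ∀ {v a} (σ : Level0 v) → Classical v a → Classical v (a ∘ₛ σ)
Classical-∘ₛ (σ , cσ) (var k<v) rewrite toSub-< σ k<v = cσ (fromℕ< k<v)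
Classical-∘ₛ σ        ⊥'        = ⊥'
Classical-∘ₛ σ        (p ⇒ q)   = Classical-∘ₛ σ p ⇒ Classical-∘ₛ σ q

Deg≤1-∘ₛ : ∀ {v a} (σ : Level0 v) → Deg≤1 v a → Deg≤1 v (a ∘ₛ σ)
Deg≤1-∘ₛ (σ , cσ) (var k<v) rewrite toSub-< σ k<v = Classical⇒Deg≤1 (cσ (fromℕ< k<v))
Deg≤1-∘ₛ σ        ⊥'        = ⊥'
Deg≤1-∘ₛ σ        (p ⇒ q)   = Deg≤1-∘ₛ σ p ⇒ Deg≤1-∘ₛ σ q
Deg≤1-∘ₛ σ        (□ c)     = □ (Classical-∘ₛ σ c)

sub-sub : ∀ s t a → sub s (sub t a) ≡ sub (sub s ∘ t) a
sub-sub s t (var k) = refl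
sub-sub s t ⊥'      = refl
sub-sub s t (a ⇒ b) = cong₂ _⇒_ (sub-sub s t a) (sub-sub s t b)
sub-sub s t (□ a)   = cong □ (sub-sub s t a)

sub-ext : ∀ {s t} → (∀ k → s k ≡ t k) → ∀ a → sub s a ≡ sub t a
sub-ext s≡t (var k) = s≡t k
sub-ext s≡t ⊥'      = refl
sub-ext s≡t (a ⇒ b) = cong₂ _⇒_ (sub-ext s≡t a) (sub-ext s≡t b)
sub-ext s≡t (□ a)   = cong □ (sub-ext s≡t a)

sub-var : ∀ a → sub var a ≡ a
sub-var (var k) = refl
sub-var ⊥'      = refl
sub-var (a ⇒ b) = cong₂ _⇒_ (sub-var a) (sub-var b)
sub-var (□ a)   = cong □ (sub-var a)

infix 4 _≈ₖ_

_≈ₖ_ : Fm → Fm → Set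
a ≈ₖ b = K⊢ (a ⇒ b) × K⊢ (b ⇒ a)

≈ₖ-refl : ∀ a → a ≈ₖ a
≈ₖ-refl a = ⇒-refl a , ⇒-refl a

⇔'⇒≈ₖ : ∀ {a b} → K⊢ (a ⇔' b) → a ≈ₖ b
⇔'⇒≈ₖ p = closed (∧-elimˡ (thm p)) , closed (∧-elimʳ (thm p))

sub-cong : ∀ {s t} → (∀ k → s k ≈ₖ t k) → ∀ a → sub s a ≈ₖ sub t a
sub-cong s≈t (var k) = s≈t k
sub-cong s≈t ⊥'      = ≈ₖ-refl ⊥'
sub-cong s≈t (a ⇒ b) with sub-cong s≈t a | sub-cong s≈t b
... | sa⇒ta , ta⇒sa | sb⇒tb , tb⇒sb =
  derive (⇒-intro (thm sb⇒tb · (#1 · (thm ta⇒sa · #0)))) ,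
  derive (⇒-intro (thm tb⇒sb · (#1 · (thm sa⇒ta · #0))))
sub-cong s≈t (□ a)   with sub-cong s≈t a
... | sa⇒ta , ta⇒sa = □-mono sa⇒ta , □-mono ta⇒sa

∘ₛ-cancel : ∀ {v} (τ τ′ : Level0 v) → (∀ k → K⊢ ((proj₁ τ′ k ∘ₛ τ) ⇔' var (toℕ k))) →
            ∀ a → (a ∘ₛ τ′) ∘ₛ τ ≈ₖ a
∘ₛ-cancel {v} (τ , _) (τ′ , _) τ′τ≈id a =
  subst₂ _≈ₖ_ (sym (sub-sub (toSub τ) (toSub τ′) a)) (sub-var a) (sub-cong pointwise a)
  where
  pointwise : ∀ k → sub (toSub τ) (toSub τ′ k) ≈ₖ var k
  pointwise k with k <? v
  ... | yes k<v = subst (λ j → sub (toSub τ) (τ′ (fromℕ< k<v)) ≈ₖ var j)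
                        (toℕ-fromℕ< k<v) (⇔'⇒≈ₖ (τ′τ≈id (fromℕ< k<v)))
  ... | no k≮v rewrite toSub-≮ τ k≮v = ≈ₖ-refl (var k)

idₛ : ∀ v → Level0 v
idₛ v = var ∘ toℕ , λ k → var (toℕ<n k)

∘ₛ-identity : ∀ {v} a → a ∘ₛ idₛ v ≡ a
∘ₛ-identity {v} a = trans (sub-ext toSub-id a) (sub-var a)
  where
  toSub-id : ∀ k → toSub {v} (var ∘ toℕ) k ≡ var k
  toSub-id k with k <? v
  ... | yes k<v = cong var (toℕ-fromℕ< k<v)
  ... | no  _   = refl

idₛ-prime : ∀ v → IsPrime (idₛ v)
idₛ-prime v = idₛ v , id-inverse , id-inverse
  where
  id-inverse : ∀ (k : Fin v) → K⊢ ((var (toℕ k) ∘ₛ idₛ v) ⇔' var (toℕ k))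
  id-inverse k rewrite ∘ₛ-identity {v} (var (toℕ k)) =
    closed (∧-intro (thm (⇒-refl _)) (thm (⇒-refl _)))

seed-∈-orbit : ∀ {v} {ω : List (Minterm v)} (o : IsPrimeOrbit ω) → proj₁ o ∈ ω
seed-∈-orbit {v} (μ₀ , orbit) = Equivalence.from (orbit μ₀)
  (idₛ v , idₛ-prime v ,
   subst (λ a → K⊢ (mform μ₀ ⇒ a)) (sym (∘ₛ-identity {v} (mform μ₀))) (⇒-refl _))

covering-witness : ∀ {v} {ωi ωj : List (Minterm v)} {σ} → IsPrimeOrbit ωj →
                   CoversPartially ωi σ ωj ⊎ CoversFully ωi σ ωj → ∃ λ μ → μ ∈ ωj × InComp μ ωi σ
covering-witness _     (inj₁ (some , _)) = some
covering-witness orbit (inj₂ full)       = _ , seed-∈-orbit orbit , full _ (seed-∈-orbit orbit)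

-- Refutation by theorems of a normal logic

module _ {L : Fm → Set} (N : NormalLogic L) where
  module L = NormalLogic N

  K⊆ : ∀ {a} → K⊢ a → L a
  K⊆ (ax1 a b)   = L.ax1 a b
  K⊆ (ax2 a b c) = L.ax2 a b c
  K⊆ (ax3 a)     = L.ax3 a
  K⊆ (axK a b)   = L.axK a b
  K⊆ (mp p q)    = L.mp (K⊆ p) (K⊆ q)
  K⊆ (nec p)     = L.nec (K⊆ p)
  K⊆ (usub s p)  = L.usub s (K⊆ p)

  L-∧' : ∀ {a b} → L a → L b → L (a ∧' b)
  L-∧' La Lb = L.mp (L.mp (K⊆ (derive (⇒-intro (∧-intro #1 #0)))) La) Lb

  RefutedIn : ℕ → Fm → Set
  RefutedIn v χ = Σ Fm λ ψ → L ψ × Deg≤1 v ψ × K⊢ (χ ⇒ ¬' ψ)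

  module _ {v : ℕ} where

    RefutedIn-∘ₛ : ∀ {χ} (σ : Level0 v) → RefutedIn v χ → RefutedIn v (χ ∘ₛ σ)
    RefutedIn-∘ₛ σ (ψ , Lψ , dψ , χ⇒¬ψ) =
      ψ ∘ₛ σ , L.usub _ Lψ , Deg≤1-∘ₛ σ dψ , usub _ χ⇒¬ψ

    RefutedIn-antitone : ∀ {χ χ′} → K⊢ (χ′ ⇒ χ) → RefutedIn v χ → RefutedIn v χ′
    RefutedIn-antitone χ′⇒χ (ψ , Lψ , dψ , χ⇒¬ψ) = ψ , Lψ , dψ , ⇒-trans χ′⇒χ χ⇒¬ψ

    RefutedIn-⋁ : ∀ {A : Set} (f : A → Fm) xs → (∀ {x} → x ∈ xs → RefutedIn v (f x)) →
                  RefutedIn v (⋁ (map f xs))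
    RefutedIn-⋁ f []       _ = ⊤' , K⊆ (⇒-refl ⊥') , ⊥' ⇒ ⊥' , derive (⊥'-elim #0)
    RefutedIn-⋁ f (x ∷ xs) h with h (here refl) | RefutedIn-⋁ f xs (h ∘ there)
    ... | ψ , Lψ , dψ , x⇒¬ψ | Ψ , LΨ , dΨ , xs⇒¬Ψ =
      ψ ∧' Ψ , L-∧' Lψ LΨ , (dψ ⇒ (dΨ ⇒ ⊥')) ⇒ ⊥' ,
      derive (∨-elim #0 (⇒-intro (⇒-intro (thm x⇒¬ψ · #1 · ∧-elimˡ #0)))
                        (⇒-intro (⇒-intro (thm xs⇒¬Ψ · #1 · ∧-elimʳ #0))))

    orbit-refuted : ∀ {ω : List (Minterm v)} (o : IsPrimeOrbit ω) →
                    RefutedIn v (mform (proj₁ o)) → ∀ {ν} → ν ∈ ω → RefutedIn v (mform ν)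
    orbit-refuted (μ₀ , orbit) seed-refuted ν∈ω with Equivalence.to (orbit _) ν∈ω
    ... | ρ , _ , ν⇒μ₀ρ = RefutedIn-antitone ν⇒μ₀ρ (RefutedIn-∘ₛ ρ seed-refuted)

    char-unrefuted : ∀ {μ : Minterm v} → InChar L μ → ¬ RefutedIn v (mform μ)
    char-unrefuted {μ} μ∈ξ (ψ , Lψ , dψ , μ⇒¬ψ) =
      minterm-consistent μ (derive (thm μ⇒¬ψ · #0 · (thm (μ∈ξ ψ dψ Lψ) · #0)))

    covered-seed-unrefuted : ∀ {ωi ωj : List (Minterm v)} {σ} (oᵢ : IsPrimeOrbit ωi) →
                             IsPrimeOrbit ωj → CoversPartially ωi σ ωj ⊎ CoversFully ωi σ ωj →
                             (∀ μ → μ ∈ ωj → InChar L μ) → ¬ RefutedIn v (mform (proj₁ oᵢ))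
    covered-seed-unrefuted {ωi} {σ = σ} oᵢ oⱼ covers ωj⊆ξ seed-refuted
      with covering-witness {ωi = ωi} {σ = σ} oⱼ covers
    ... | μ′ , μ′∈ωj , μ′∈ωiσ =
      char-unrefuted (ωj⊆ξ μ′ μ′∈ωj) (RefutedIn-antitone μ′∈ωiσ (RefutedIn-∘ₛ σ
        (RefutedIn-⋁ mform ωi (orbit-refuted oᵢ seed-refuted))))

claim9 : (v : ℕ) → 1 ≤ v → (ωi ωj : List (Minterm v)) → IsPrimeOrbit ωi → IsPrimeOrbit ωj
       → (σ : Level0 v) → CoversPartially ωi σ ωj ⊎ CoversFully ωi σ ωj
       → (L : Fm → Set) → NormalLogic L
       → (∀ μ → μ ∈ ωj → InChar L μ) → (∀ μ → μ ∈ ωi → InChar L μ)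
claim9 v _ ωi ωj oᵢ@(μ₀ , orbitᵢ) oⱼ σ covers L N ωj⊆ξ μ μ∈ωi φ dφ Lφ
  with Equivalence.to (orbitᵢ μ) μ∈ωi
... | τ , (τ′ , _ , τ′τ≈id) , μ⇒μ₀τ with mform-decides μ₀ (Deg≤1-∘ₛ τ′ dφ)
... | inj₁ μ₀⇒φτ′ = ⇒-trans μ⇒μ₀τ (⇒-trans (usub _ μ₀⇒φτ′) (proj₁ (∘ₛ-cancel τ τ′ τ′τ≈id φ)))
... | inj₂ μ₀⇒¬φτ′ = ⊥-elim (covered-seed-unrefuted N {σ = σ} oᵢ oⱼ covers ωj⊆ξ
                       (φ ∘ₛ τ′ , NormalLogic.usub N _ Lφ , Deg≤1-∘ₛ τ′ dφ , μ₀⇒¬φτ′))
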